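{- Let $G$ be a $2$-connected graph, and let $P$ be a path in $G$ of length at least three such that every internal vertex of $P$ has degree two in $G$. Then for any rainbow $2$-connected colouring of $G$, the edges of $P$ receive pairwise distinct colours.
   Context: All graphs are finite, simple and undirected. An edge-colouring of $G$ is any function from $E(G)$ to a set of colours (not necessarily proper). A path is rainbow if all its edges have distinct colours. For a $2$-connected graph $G$, an edge-colouring is rainbow $2$-connected if every two vertices of $G$ are connected by two internally vertex-disjoint rainbow paths. -}

module Defs where

open import Data.Nat using (ℕ; zero; suc; _≤_)
open import Data.Bool using (Bool; true; false; if_then_else_)
open import Data.Fin using (Fin)
open import Data.List using (List; []; _∷_; length; head; last; map; allFin)
open import Data.Nat.ListAction using (sum)
open import Data.List.Relation.Unary.Linked using (Linked)
open import Data.List.Relation.Unary.Unique.Propositional using (Unique)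
open import Data.List.Membership.Propositional using (_∈_; _∉_)
open import Data.Maybe using (Maybe; just)
open import Data.Product using (Σ; _×_; ∃; ∃-syntax)
open import Relation.Binary.PropositionalEquality using (_≡_; _≢_)

record Graph (n : ℕ) : Set where
  field
    adj     : Fin n → Fin n → Bool
    adj-sym : ∀ u v → adj u v ≡ adj v u
    irrefl  : ∀ v → adj v v ≡ false

open Graph public

Adj : {n : ℕ} → Graph n → Fin n → Fin n → Set
Adj G u v = adj G u v ≡ true

degree : {n : ℕ} → Graph n → Fin n → ℕ
degree {n} G v = sum (map (λ w → if adj G v w then 1 else 0) (allFin n))

-- A path is given by its vertex sequence: consecutive vertices adjacent,
-- all vertices distinct.  Its length is (number of vertices − 1).
IsPath : {n : ℕ} → Graph n → List (Fin n) → Set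
IsPath G vs = Linked (Adj G) vs × Unique vs

PathBetween : {n : ℕ} → Graph n → Fin n → Fin n → List (Fin n) → Set
PathBetween G u v vs = IsPath G vs × head vs ≡ just u × last vs ≡ just v

pathLength : {n : ℕ} → List (Fin n) → ℕ
pathLength []       = 0
pathLength (_ ∷ vs) = length vs

dropLast : {A : Set} → List A → List A
dropLast []           = []
dropLast (x ∷ [])     = []
dropLast (x ∷ y ∷ xs) = x ∷ dropLast (y ∷ xs)

interior : {A : Set} → List A → List A
interior []       = []
interior (_ ∷ xs) = dropLast xs

Connected : {n : ℕ} → Graph n → Set
Connected {n} G = ∀ (u v : Fin n) → ∃[ p ] PathBetween G u v p

TwoConnected : {n : ℕ} → Graph n → Set
TwoConnected {n} G =
  3 ≤ n × Connected G ×
  (∀ (x u v : Fin n) → u ≢ x → v ≢ x → ∃[ p ] (PathBetween G u v p × x ∉ p))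

-- An edge-colouring with colour set C: a symmetric function on pairs of
-- vertices (only its values on edges matter), i.e. a function on unordered pairs.
record Colouring {n : ℕ} (G : Graph n) (C : Set) : Set where
  field
    col     : Fin n → Fin n → C
    col-sym : ∀ u v → col u v ≡ col v u

open Colouring public

edgeColours : {n : ℕ} {G : Graph n} {C : Set} → Colouring G C → List (Fin n) → List C
edgeColours c []           = []
edgeColours c (x ∷ [])     = []
edgeColours c (x ∷ y ∷ vs) = col c x y ∷ edgeColours c (y ∷ vs)

Rainbow : {n : ℕ} {G : Graph n} {C : Set} → Colouring G C → List (Fin n) → Set
Rainbow c vs = Unique (edgeColours c vs)

InternallyDisjoint : {n : ℕ} → List (Fin n) → List (Fin n) → Set
InternallyDisjoint p q = ∀ w → w ∈ interior p → w ∉ interior q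

Rainbow2Connected : {n : ℕ} {G : Graph n} {C : Set} → Colouring G C → Set
Rainbow2Connected {n} {G} c =
  ∀ (u v : Fin n) → u ≢ v →
    ∃[ p ] ∃[ q ] (PathBetween G u v p × PathBetween G u v q × p ≢ q ×
                   InternallyDisjoint p q × Rainbow c p × Rainbow c q)

-- Let u be an interior vertex of P and Q a segment of P from u to a vertex w. As u has
-- degree two, the two internally disjoint rainbow u–w paths leave u through its two
-- neighbours, and the one that steps onto Q can never leave it, since every vertex it
-- meets has degree two: it is Q itself, so Q is rainbow. This separates two adjacent
-- edges of P, one of whose outer vertices is interior because P has length at least
-- three. For non-adjacent edges ab and de, with b before d, the other rainbow b–d path
-- starts with ba and avoids the interior of the segment from b to d, so it enters d
-- through e and contains both ba and ed.

module Submission where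

open import Defs
open import Algebra.Properties.CommutativeSemigroup using (x∙yz≈y∙xz)
open import Data.Bool using (if_then_else_)
open import Data.Empty using (⊥-elim)
open import Data.Fin using (Fin; _≟_)
open import Data.List using (List; []; _∷_; _++_; map; allFin; head; last; _∷ʳ_; initLast; _∷ʳ′_)
open import Data.List.Membership.Propositional using (_∈_; _∉_)
open import Data.List.Membership.Propositional.Properties using (∈-++⁺ʳ; ∈-allFin)
open import Data.List.Properties using (++-assoc; ++-identityʳ)
open import Data.List.Relation.Unary.All as All using (All; []; _∷_)
open import Data.List.Relation.Unary.All.Properties using (++⁺; ++⁻ˡ; ++⁻ʳ)
open import Data.List.Relation.Unary.AllPairs using (AllPairs; []; _∷_)
open import Data.List.Relation.Unary.Any using (here; there; _─_)
open import Data.List.Relation.Unary.Unique.Propositional.Properties using (Unique[x∷xs]⇒x∉xs)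
open import Data.List.Relation.Unary.Linked as Linked using (Linked; []; [-]; _∷_)
open import Data.Maybe using (just)
open import Data.Maybe.Properties using (just-injective)
open import Data.Nat using (ℕ; _+_; _≤_; s≤s; z≤n)
open import Data.Nat.ListAction using (sum)
open import Data.Nat.Properties using (+-commutativeSemigroup; <-irrefl)
open import Data.Product using (∃; ∃₂; _×_; _,_; proj₁; proj₂)
open import Data.Sum using (_⊎_; inj₁; inj₂)
open import Function using (_∘_)
open import Relation.Nullary using (yes; no)
open import Relation.Binary.PropositionalEquality
  using (_≡_; _≢_; refl; sym; trans; cong; subst; ≢-sym)

module _ {A : Set} where

  dropLast-++ : (X : List A) {y : A} {Y : List A} → dropLast (X ++ y ∷ Y) ≡ X ++ dropLast (y ∷ Y)
  dropLast-++ []           = refl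
  dropLast-++ (x ∷ [])     = refl
  dropLast-++ (x ∷ x′ ∷ X) = cong (x ∷_) (dropLast-++ (x′ ∷ X))

  dropLast-∷ʳ : (X : List A) {y : A} → dropLast (X ++ y ∷ []) ≡ X
  dropLast-∷ʳ X = trans (dropLast-++ X) (++-identityʳ X)

  ∈-dropLast⁻ : ∀ {v} (X : List A) → v ∈ dropLast X → v ∈ X
  ∈-dropLast⁻ (x ∷ y ∷ X) (here v≡x) = here v≡x
  ∈-dropLast⁻ (x ∷ y ∷ X) (there v∈) = there (∈-dropLast⁻ (y ∷ X) v∈)

  ∈-interior-++⁺ʳ : ∀ {v} (X : List A) {Y : List A} → v ∈ interior Y → v ∈ interior (X ++ Y)
  ∈-interior-++⁺ʳ []      v∈ = v∈
  ∈-interior-++⁺ʳ {v} (x ∷ X) {y ∷ y′ ∷ Y} v∈ =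
    subst (v ∈_) (sym (dropLast-++ X)) (∈-++⁺ʳ X (there v∈))

  last-∷ʳ : (X : List A) {y : A} → last (X ++ y ∷ []) ≡ just y
  last-∷ʳ []           = refl
  last-∷ʳ (x ∷ [])     = refl
  last-∷ʳ (x ∷ x′ ∷ X) = last-∷ʳ (x′ ∷ X)

  last-just : (x : A) (X : List A) → ∃ λ w → last (x ∷ X) ≡ just w
  last-just x []      = x , refl
  last-just x (y ∷ X) = last-just y X

  head≢last⇒∷∷ : ∀ {u w : A} (X : List A) → head X ≡ just u → last X ≡ just w → u ≢ w →
                 ∃₂ λ x X′ → X ≡ u ∷ x ∷ X′
  head≢last⇒∷∷ (x ∷ [])     refl refl u≢w = ⊥-elim (u≢w refl)
  head≢last⇒∷∷ (x ∷ y ∷ X′) refl _    _   = y , X′ , refl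

  ∈-─ : ∀ {x y : A} {xs : List A} (x∈ : x ∈ xs) → y ∈ xs → y ≢ x → y ∈ (xs ─ x∈)
  ∈-─ (here refl) (here refl) y≢x = ⊥-elim (y≢x refl)
  ∈-─ (here refl) (there y∈)  _   = y∈
  ∈-─ (there x∈)  (here refl) _   = here refl
  ∈-─ (there x∈)  (there y∈)  y≢x = there (∈-─ x∈ y∈ y≢x)

  last-∈ : ∀ {w} (x : A) (X : List A) → last (x ∷ X) ≡ just w → w ∈ x ∷ X
  last-∈ x []      eq = here (sym (just-injective eq))
  last-∈ x (y ∷ X) eq = there (last-∈ y X eq)

module _ {A : Set} {R : A → A → Set} where

  Linked-++⁻ʳ : (X : List A) {Y : List A} → Linked R (X ++ Y) → Linked R Y
  Linked-++⁻ʳ []      l = l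
  Linked-++⁻ʳ (x ∷ X) l = Linked-++⁻ʳ X (Linked.tail l)

  Linked-prefix : (X : List A) {y : A} {Y : List A} → Linked R (X ++ y ∷ Y) → Linked R (X ++ y ∷ [])
  Linked-prefix []           l = [-]
  Linked-prefix (x ∷ [])     l = Linked.head l ∷ [-]
  Linked-prefix (x ∷ x′ ∷ X) l = Linked.head l ∷ Linked-prefix (x′ ∷ X) (Linked.tail l)

  AllPairs-++⁻ʳ : (X : List A) {Y : List A} → AllPairs R (X ++ Y) → AllPairs R Y
  AllPairs-++⁻ʳ []      u       = u
  AllPairs-++⁻ʳ (x ∷ X) (_ ∷ u) = AllPairs-++⁻ʳ X u

  AllPairs-prefix : (X : List A) {y : A} {Y : List A} → AllPairs R (X ++ y ∷ Y) → AllPairs R (X ++ y ∷ [])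
  AllPairs-prefix []      (_ ∷ _)  = [] ∷ []
  AllPairs-prefix (x ∷ X) (px ∷ u) =
    ++⁺ (++⁻ˡ X px) (All.head (++⁻ʳ X px) ∷ []) ∷ AllPairs-prefix X u

  AllPairs-across : (X : List A) {Y : List A} {x y : A} → AllPairs R (X ++ Y) → x ∈ X → y ∈ Y → R x y
  AllPairs-across (x ∷ X) (px ∷ _) (here refl) y∈ = All.lookup px (∈-++⁺ʳ X y∈)
  AllPairs-across (x ∷ X) (_ ∷ u)  (there x∈) y∈  = AllPairs-across X u x∈ y∈

data Consecutive {A : Set} (x y : A) : List A → Set where
  here  : ∀ {zs} → Consecutive x y (x ∷ y ∷ zs)
  there : ∀ {z zs} → Consecutive x y zs → Consecutive x y (z ∷ zs)

module _ {A : Set} where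

  Consecutive-++ : (X : List A) {x y : A} {Y : List A} → Consecutive x y (X ++ x ∷ y ∷ Y)
  Consecutive-++ []      = here
  Consecutive-++ (_ ∷ X) = there (Consecutive-++ X)

  Linked-Consecutive : ∀ {R : A → A → Set} {X : List A} {x y : A} → Linked R X → Consecutive x y X → R x y
  Linked-Consecutive l here      = Linked.head l
  Linked-Consecutive l (there c) = Linked-Consecutive (Linked.tail l) c

  Consecutive⇒∈dropLast : ∀ {X : List A} {x y : A} → Consecutive x y X → x ∈ dropLast X
  Consecutive⇒∈dropLast here                 = here refl
  Consecutive⇒∈dropLast (there {zs = _ ∷ _} c) = there (Consecutive⇒∈dropLast c)

  Consecutive-last : ∀ {x w : A} {X} → x ≢ w → last (x ∷ X) ≡ just w → ∃ λ t → Consecutive t w (x ∷ X)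
  Consecutive-last {X = []}    x≢w eq = ⊥-elim (x≢w (just-injective eq))
  Consecutive-last {X = y ∷ X} _   eq = last-edge eq
    where
    last-edge : ∀ {x y w X} → last (x ∷ y ∷ X) ≡ just w → ∃ λ t → Consecutive t w (x ∷ y ∷ X)
    last-edge {X = []}    refl = _ , here
    last-edge {X = z ∷ X} eq   with last-edge {X = X} eq
    ... | t , c = t , there c

  penultimate-∷ʳ : (x : A) (X : List A) {y : A} → ∃ λ p → p ∈ x ∷ X × Consecutive p y (x ∷ X ++ y ∷ [])
  penultimate-∷ʳ x []       = x , here refl , here
  penultimate-∷ʳ x (x′ ∷ X) with penultimate-∷ʳ x′ X
  ... | p , p∈ , c = p , there p∈ , there c

module _ {A : Set} (f : A → ℕ) where

  sum-map-─ : ∀ {x : A} {xs : List A} (x∈ : x ∈ xs) → sum (map f xs) ≡ f x + sum (map f (xs ─ x∈))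
  sum-map-─ (here refl)             = refl
  sum-map-─ {x} {y ∷ xs} (there x∈) =
    trans (cong (f y +_) (sum-map-─ x∈)) (x∙yz≈y∙xz +-commutativeSemigroup (f y) (f x) _)

  3≤sum-map : ∀ {x y z : A} {xs : List A} → x ∈ xs → y ∈ xs → z ∈ xs → y ≢ x → z ≢ x → z ≢ y →
              f x ≡ 1 → f y ≡ 1 → f z ≡ 1 → 3 ≤ sum (map f xs)
  3≤sum-map {x} {y} {z} {xs} x∈ y∈ z∈ y≢x z≢x z≢y fx fy fz =
    subst (3 ≤_) (sym expand) (three-ones fx fy fz)
    where
    y∈′ : y ∈ (xs ─ x∈)
    y∈′ = ∈-─ x∈ y∈ y≢x
    z∈′ : z ∈ ((xs ─ x∈) ─ y∈′)
    z∈′ = ∈-─ y∈′ (∈-─ x∈ z∈ z≢x) z≢y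
    expand : sum (map f xs) ≡ f x + (f y + (f z + sum (map f (((xs ─ x∈) ─ y∈′) ─ z∈′))))
    expand = trans (sum-map-─ x∈) (cong (f x +_) (trans (sum-map-─ y∈′) (cong (f y +_) (sum-map-─ z∈′))))
    three-ones : ∀ {a b c s} → a ≡ 1 → b ≡ 1 → c ≡ 1 → 3 ≤ a + (b + (c + s))
    three-ones refl refl refl = s≤s (s≤s (s≤s z≤n))

module _ {n : ℕ} (G : Graph n) where

  DegreeTwoInterior : List (Fin n) → Set
  DegreeTwoInterior p = All (λ v → degree G v ≡ 2) (interior p)

  Adj-sym : ∀ {x y} → Adj G x y → Adj G y x
  Adj-sym {x} {y} xy = trans (adj-sym G y x) xy

  degree-two-neighbours : ∀ {v x y t} → degree G v ≡ 2 → Adj G v x → Adj G v y → x ≢ y →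
                          Adj G v t → t ≡ x ⊎ t ≡ y
  degree-two-neighbours {v} {x} {y} {t} deg vx vy x≢y vt with t ≟ x | t ≟ y
  ... | yes t≡x | _       = inj₁ t≡x
  ... | no _    | yes t≡y = inj₂ t≡y
  ... | no t≢x  | no t≢y  = ⊥-elim (<-irrefl refl (subst (3 ≤_) deg three))
    where
    indicator : Fin n → ℕ
    indicator w = if adj G v w then 1 else 0
    one-at : ∀ {w} → Adj G v w → indicator w ≡ 1
    one-at = cong (λ b → if b then 1 else 0)
    three : 3 ≤ degree G v
    three = 3≤sum-map indicator (∈-allFin x) (∈-allFin y) (∈-allFin t) (≢-sym x≢y) t≢x t≢y
              (one-at vx) (one-at vy) (one-at vt)

  IsPath-++⁻ʳ : (X : List (Fin n)) {Y : List (Fin n)} → IsPath G (X ++ Y) → IsPath G Y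
  IsPath-++⁻ʳ X (linked , unique) = Linked-++⁻ʳ X linked , AllPairs-++⁻ʳ X unique

  IsPath-prefix : (X : List (Fin n)) {y : Fin n} {Y : List (Fin n)} → IsPath G (X ++ y ∷ Y) → IsPath G (X ++ y ∷ [])
  IsPath-prefix X (linked , unique) = Linked-prefix X linked , AllPairs-prefix X unique

  DegreeTwoInterior-++⁻ʳ : (X : List (Fin n)) {Y : List (Fin n)} → DegreeTwoInterior (X ++ Y) → DegreeTwoInterior Y
  DegreeTwoInterior-++⁻ʳ X deg = All.tabulate (λ v∈ → All.lookup deg (∈-interior-++⁺ʳ X v∈))

  second-vertices-differ : ∀ {u x x′ w : Fin n} {p q : List (Fin n)} → IsPath G (u ∷ x ∷ p) → IsPath G (u ∷ x′ ∷ q) →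
                           last (x ∷ p) ≡ just w → last (x′ ∷ q) ≡ just w → _≢_ {A = List (Fin n)} (u ∷ x ∷ p) (u ∷ x′ ∷ q) →
                           InternallyDisjoint (u ∷ x ∷ p) (u ∷ x′ ∷ q) → x ≢ x′
  second-vertices-differ {p = []}    {[]}    _ _ refl refl p≢q _ refl = p≢q refl
  second-vertices-differ {p = []}    {y ∷ q} _ (_ , (_ ∷ x∉ ∷ _)) refl ends _ _ refl =
    All.lookup x∉ (last-∈ y q ends) refl
  second-vertices-differ {p = y ∷ p} {[]}    (_ , (_ ∷ x∉ ∷ _)) _ ends refl _ _ refl =
    All.lookup x∉ (last-∈ y p ends) refl
  second-vertices-differ {p = _ ∷ _} {_ ∷ _} _ _ _ _ _ disjoint refl = disjoint _ (here refl) (here refl)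

  path-determined : ∀ {x y R q} → IsPath G (x ∷ y ∷ R) → DegreeTwoInterior (x ∷ y ∷ R) →
                    IsPath G (x ∷ y ∷ q) → last (y ∷ q) ≡ last (y ∷ R) → q ≡ R
  path-determined {R = []}    {[]}    _ _ _ _ = refl
  path-determined {R = []}    {s ∷ q} _ _ (_ , (_ ∷ y∉ ∷ _)) ends =
    ⊥-elim (All.lookup y∉ (last-∈ s q ends) refl)
  path-determined {R = r ∷ R} {[]}    (_ , (_ ∷ y∉ ∷ _)) _ _ ends =
    ⊥-elim (All.lookup y∉ (last-∈ r R (sym ends)) refl)
  path-determined {R = r ∷ R} {s ∷ q} (xy ∷ yr , (x∉ ∷ unique)) (deg-y ∷ deg)
                  (_ ∷ ys , (x∉′ ∷ unique′)) ends
    with degree-two-neighbours deg-y (Adj-sym xy) (Linked.head yr) (All.lookup x∉ (there (here refl)))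
                               (Linked.head ys)
  ... | inj₁ refl = ⊥-elim (All.lookup x∉′ (there (here refl)) refl)
  ... | inj₂ refl = cong (s ∷_) (path-determined (yr , unique) deg (ys , unique′) ends)

  detour-enters-through : ∀ {a b d e rest} (M : List (Fin n)) → Linked (Adj G) (b ∷ M ++ d ∷ []) →
                          IsPath G (b ∷ a ∷ rest) → last (a ∷ rest) ≡ just d →
                          InternallyDisjoint (b ∷ M ++ d ∷ []) (b ∷ a ∷ rest) →
                          degree G d ≡ 2 → Adj G d e → e ∉ b ∷ M → a ≢ d → Consecutive e d (a ∷ rest)
  detour-enters-through {a} {b} {d} {e} {rest} M segment (linked , unique) ends disjoint deg-d de e∉ a≢d
    with penultimate-∷ʳ b M | Consecutive-last a≢d ends
  ... | p , p∈ , p→d | t , t→d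
    with degree-two-neighbours deg-d (Adj-sym (Linked-Consecutive segment p→d)) de
           (λ p≡e → e∉ (subst (_∈ b ∷ M) p≡e p∈))
           (Adj-sym (Linked-Consecutive (Linked.tail linked) t→d))
  ... | inj₂ refl = t→d
  ... | inj₁ refl with p∈
  ...   | here refl = ⊥-elim (Unique[x∷xs]⇒x∉xs unique (∈-dropLast⁻ (a ∷ rest) (Consecutive⇒∈dropLast t→d)))
  ...   | there p∈M = ⊥-elim (disjoint _ (subst (_ ∈_) (sym (dropLast-∷ʳ M)) p∈M) (Consecutive⇒∈dropLast t→d))

  module _ {C : Set} (c : Colouring G C) where

    Consecutive⇒∈edgeColours : ∀ {X x y} → Consecutive x y X → col c x y ∈ edgeColours c X
    Consecutive⇒∈edgeColours here                   = here refl
    Consecutive⇒∈edgeColours (there {zs = _ ∷ _} c) = there (Consecutive⇒∈edgeColours c)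

    ∈-edgeColours⁻ : ∀ {k} (X : List (Fin n)) → k ∈ edgeColours c X →
                     ∃₂ λ M d → ∃₂ λ e D → X ≡ M ++ d ∷ e ∷ D × k ≡ col c d e
    ∈-edgeColours⁻ (x ∷ y ∷ X) (here k≡) = [] , x , y , X , refl , k≡
    ∈-edgeColours⁻ (x ∷ y ∷ X) (there k∈) with ∈-edgeColours⁻ (y ∷ X) k∈
    ... | M , d , e , D , eq , k≡ = x ∷ M , d , e , D , cong (x ∷_) eq , k≡

    Rainbow-if-edges-differ : (X : List (Fin n)) →
      (∀ A a b e D → X ≡ A ++ a ∷ b ∷ e ∷ D → col c a b ≢ col c b e) →
      (∀ A a b M d e D → X ≡ A ++ a ∷ b ∷ M ++ d ∷ e ∷ D → col c a b ≢ col c d e) →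
      Rainbow c X
    Rainbow-if-edges-differ []          _        _         = []
    Rainbow-if-edges-differ (x ∷ [])    _        _         = []
    Rainbow-if-edges-differ (x ∷ y ∷ X) adjacent separated =
      All.tabulate first-edge
      ∷ Rainbow-if-edges-differ (y ∷ X)
          (λ A a b e D eq → adjacent (x ∷ A) a b e D (cong (x ∷_) eq))
          (λ A a b M d e D eq → separated (x ∷ A) a b M d e D (cong (x ∷_) eq))
      where
      first-edge : ∀ {k} → k ∈ edgeColours c (y ∷ X) → col c x y ≢ k
      first-edge k∈ with ∈-edgeColours⁻ (y ∷ X) k∈
      ... | []    , _ , e , D , refl , refl = adjacent [] x y e D refl
      ... | _ ∷ M , d , e , D , refl , refl = separated [] x y M d e D refl

    module _ (r2c : Rainbow2Connected c) where

      record Detour (u z w : Fin n) (Q : List (Fin n)) : Set where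
        field
          rest     : List (Fin n)
          isPath   : IsPath G (u ∷ z ∷ rest)
          ends     : last (z ∷ rest) ≡ just w
          disjoint : InternallyDisjoint Q (u ∷ z ∷ rest)
          rainbow  : Rainbow c (u ∷ z ∷ rest)

      rainbow-segment-with-detour : ∀ {z u w S} → IsPath G (z ∷ u ∷ S) → DegreeTwoInterior (z ∷ u ∷ S) →
                                    last S ≡ just w → Rainbow c (u ∷ S) × Detour u z w (u ∷ S)
      rainbow-segment-with-detour {S = []} _ _ ()
      rainbow-segment-with-detour {z} {u} {w} {y ∷ R} (zu ∷ linked , z∉ ∷ unique) (deg-u ∷ deg) ends =
        let (p , q , p-from-to , q-from-to , p≢q , disjoint , rainbow-p , rainbow-q) = r2c u w u≢w
        in  choose p-from-to q-from-to p≢q disjoint rainbow-p rainbow-q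
        where
        u≢w : u ≢ w
        u≢w refl = Unique[x∷xs]⇒x∉xs unique (last-∈ y R ends)

        neighbours : ∀ {x} → Adj G u x → x ≡ z ⊎ x ≡ y
        neighbours = degree-two-neighbours deg-u (Adj-sym zu) (Linked.head linked)
                                           (All.lookup z∉ (there (here refl)))

        along-segment : ∀ {p q} → IsPath G (u ∷ y ∷ p) → last (y ∷ p) ≡ just w →
                        IsPath G (u ∷ z ∷ q) → last (z ∷ q) ≡ just w →
                        InternallyDisjoint (u ∷ y ∷ p) (u ∷ z ∷ q) →
                        Rainbow c (u ∷ y ∷ p) → Rainbow c (u ∷ z ∷ q) →
                        Rainbow c (u ∷ y ∷ R) × Detour u z w (u ∷ y ∷ R)
        along-segment path-p ends-p path-q ends-q disjoint rainbow-p rainbow-q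
          with path-determined (linked , unique) deg path-p (trans ends-p (sym ends))
        ... | refl = rainbow-p , record { rest = _ ; isPath = path-q ; ends = ends-q
                                        ; disjoint = disjoint ; rainbow = rainbow-q }

        choose : ∀ {p q} → PathBetween G u w p → PathBetween G u w q → p ≢ q → InternallyDisjoint p q →
                 Rainbow c p → Rainbow c q → Rainbow c (u ∷ y ∷ R) × Detour u z w (u ∷ y ∷ R)
        choose {p} {q} (path-p , head-p , last-p) (path-q , head-q , last-q) p≢q disjoint rainbow-p rainbow-q
          with head≢last⇒∷∷ p head-p last-p u≢w | head≢last⇒∷∷ q head-q last-q u≢w
        ... | x , _ , refl | x′ , _ , refl
          with neighbours (Linked.head (proj₁ path-p)) | neighbours (Linked.head (proj₁ path-q))
        ... | inj₂ refl | inj₁ refl = along-segment path-p last-p path-q last-q disjoint rainbow-p rainbow-q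
        ... | inj₁ refl | inj₂ refl =
          along-segment path-q last-q path-p last-p (λ v v∈q v∈p → disjoint v v∈p v∈q) rainbow-q rainbow-p
        ... | inj₁ refl | inj₁ refl = ⊥-elim (second-vertices-differ path-p path-q last-p last-q p≢q disjoint refl)
        ... | inj₂ refl | inj₂ refl = ⊥-elim (second-vertices-differ path-p path-q last-p last-q p≢q disjoint refl)

      tail-rainbow : ∀ {z u y R} → IsPath G (z ∷ u ∷ y ∷ R) → DegreeTwoInterior (z ∷ u ∷ y ∷ R) →
                     Rainbow c (u ∷ y ∷ R)
      tail-rainbow {y = y} {R} path deg = proj₁ (rainbow-segment-with-detour path deg (proj₂ (last-just y R)))

      separated-edges-differ : ∀ {a b d e} (M : List (Fin n)) {D : List (Fin n)} →
                           IsPath G (a ∷ b ∷ M ++ d ∷ e ∷ D) → DegreeTwoInterior (a ∷ b ∷ M ++ d ∷ e ∷ D) →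
                           col c a b ≢ col c d e
      separated-edges-differ {a} {b} {d} {e} M {D} path@(linked , unique) deg same =
        Unique[x∷xs]⇒x∉xs rainbow (subst (_∈ edgeColours c (a ∷ rest)) (sym flipped) (Consecutive⇒∈edgeColours e→d))
        where
        segment : IsPath G (a ∷ b ∷ M ++ d ∷ [])
        segment = IsPath-prefix (a ∷ b ∷ M) path

        degrees : All (λ v → degree G v ≡ 2) (b ∷ M ++ d ∷ dropLast (e ∷ D))
        degrees = subst (All _) (dropLast-++ (b ∷ M)) deg

        detour : Detour b a d (b ∷ M ++ d ∷ [])
        detour = proj₂ (rainbow-segment-with-detour segment
                          (subst (All _) (sym (dropLast-∷ʳ (b ∷ M))) (++⁻ˡ (b ∷ M) degrees)) (last-∷ʳ M))
        open Detour detour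

        e→d : Consecutive e d (a ∷ rest)
        e→d = detour-enters-through M (Linked.tail (proj₁ segment)) isPath ends disjoint
                (All.head (++⁻ʳ (b ∷ M) degrees))
                (Linked-Consecutive linked (Consecutive-++ (a ∷ b ∷ M)))
                (λ e∈ → AllPairs-across (a ∷ b ∷ M) unique (there e∈) (there (here refl)) refl)
                (AllPairs-across (a ∷ b ∷ M) unique (here refl) (here refl))

        flipped : col c b a ≡ col c e d
        flipped = trans (col-sym c b a) (trans same (col-sym c d e))

      adjacent-edges-differ : ∀ (A : List (Fin n)) {a b e D} →
                              IsPath G (A ++ a ∷ b ∷ e ∷ D) → DegreeTwoInterior (A ++ a ∷ b ∷ e ∷ D) →
                              3 ≤ pathLength (A ++ a ∷ b ∷ e ∷ D) → col c a b ≢ col c b e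
      adjacent-edges-differ A path deg long with initLast A
      ... | [] = initial path deg long
        where
        -- Here a is an end of P, so e is interior: read the path backwards from e's other neighbour.
        initial : ∀ {a b e D} → IsPath G (a ∷ b ∷ e ∷ D) → DegreeTwoInterior (a ∷ b ∷ e ∷ D) →
                  3 ≤ pathLength (a ∷ b ∷ e ∷ D) → col c a b ≢ col c b e
        initial {D = []} _ _ (s≤s (s≤s ()))
        initial {a} {b} {e} {f ∷ D} (ab ∷ be ∷ ef ∷ _ , (a≢b ∷ a≢e ∷ a≢f ∷ _) ∷ (b≢e ∷ b≢f ∷ _) ∷ (e≢f ∷ _) ∷ _)
                (deg-b ∷ deg-e ∷ _) _ same =
          Unique[x∷xs]⇒x∉xs (tail-rainbow reversed (deg-e ∷ deg-b ∷ [])) (here flipped)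
          where
          reversed : IsPath G (f ∷ e ∷ b ∷ a ∷ [])
          reversed = Adj-sym ef ∷ Adj-sym be ∷ Adj-sym ab ∷ [-]
                   , (≢-sym e≢f ∷ ≢-sym b≢f ∷ ≢-sym a≢f ∷ []) ∷ (≢-sym b≢e ∷ ≢-sym a≢e ∷ []) ∷ (≢-sym a≢b ∷ []) ∷ [] ∷ []
          flipped : col c e b ≡ col c b a
          flipped = trans (col-sym c e b) (trans (sym same) (col-sym c a b))
      ... | A′ ∷ʳ′ z =
        Unique[x∷xs]⇒x∉xs (tail-rainbow (IsPath-++⁻ʳ A′ (subst (IsPath G) shift path))
                                        (DegreeTwoInterior-++⁻ʳ A′ (subst DegreeTwoInterior shift deg)))
                           ∘ here
        where
        shift : ∀ {X} → (A′ ∷ʳ z) ++ X ≡ A′ ++ z ∷ X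
        shift = ++-assoc A′ (z ∷ []) _

lemma2p7 : {n : ℕ} (G : Graph n) → TwoConnected G →
           (P : List (Fin n)) → IsPath G P → 3 ≤ pathLength P →
           All (λ v → degree G v ≡ 2) (interior P) →
           {C : Set} (c : Colouring G C) → Rainbow2Connected c →
           Rainbow c P
lemma2p7 G _ P path long deg c r2c = Rainbow-if-edges-differ G c P adjacent separated
  where
  adjacent : ∀ A a b e D → P ≡ A ++ a ∷ b ∷ e ∷ D → col c a b ≢ col c b e
  adjacent A _ _ _ _ refl = adjacent-edges-differ G c r2c A path deg long
  separated : ∀ A a b M d e D → P ≡ A ++ a ∷ b ∷ M ++ d ∷ e ∷ D → col c a b ≢ col c d e
  separated A _ _ M _ _ _ refl =
    separated-edges-differ G c r2c M (IsPath-++⁻ʳ G A path) (DegreeTwoInterior-++⁻ʳ G A deg)
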